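{- Let $\mathcal{M}$ be a model of $\mathsf{HA}$ such that $\mathsf{std}$ is stable and $\neg(\mathcal{M}\cong\mathbb{N})$. Then for every unary formula $\alpha(x)$, $$\neg\neg\,\exists c:\mathcal{M}\ \forall u:\mathbb{N}.\ \mathcal{M}\vDash\alpha(\overline{u})\leftrightarrow\Pi(\overline{u})\mid c.$$
   Context: Meta-theory: constructive type theory (Calculus of Inductive Constructions), no classical axioms assumed. A predicate $p$ is stable if $\neg\neg p\,x\to p\,x$ for all $x$. Arithmetic signature $0,S,+,\times,=$; $\mathsf{HA}$ is Heyting arithmetic (axioms for successor disjointness/injectivity, recursion equations for $+$ and $\times$, equality axioms, induction scheme for all formulas, intuitionistic deduction); $\mathsf{Q}$ is Robinson arithmetic (same without induction, plus $\forall x.\,x=0\lor\exists y.\,x=Sy$). A model $\mathcal{M}$ of $\mathsf{HA}$ is a type with interpretations of $0,S,+,\times$, $=$ interpreted as actual equality, satisfying the $\mathsf{HA}$ axioms under Tarski semantics. $\overline{n}$ is the numeral $S^n0$ and its value in $\mathcal{M}$; $x\mid y:=\exists k.\,x\times k=y$. $\mathsf{std}(e):=\exists n:\mathbb{N}.\ \overline{n}=e$; $\mathcal{M}\cong\mathbb{N}$ means there is a bijective homomorphism $\mathbb{N}\to\mathcal{M}$. Let $\pi:\mathbb{N}\to\mathbb{N}$ be an injective function whose values are all primes, and $\Pi(x,y)$ a binary formula with $\mathsf{Q}\vdash\forall y.\,\Pi(\overline{n},y)\leftrightarrow\overline{\pi(n)}=y$ for all $n$ (exists under Church's thesis $\mathsf{CT_Q}$).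 $\Pi(u)\mid c$ abbreviates $\exists p.\,\Pi(u,p)\land p\mid c$. -}

module Defs where

open import Data.Nat using (ℕ; zero; suc; _+_; _*_; _<_)
open import Data.Empty using (⊥)
open import Data.Product using (Σ; ∃; _×_; _,_)
open import Data.Sum using (_⊎_)
open import Data.List using (List; []; _∷_; map)
open import Data.List.Membership.Propositional using (_∈_)
open import Data.List.Relation.Unary.All using (All)
open import Relation.Binary.PropositionalEquality using (_≡_)
open import Function.Definitions using (Bijective)

data Term : Set where
  var : ℕ → Term
  O   : Term
  S   : Term → Term
  _⊕_ : Term → Term → Term
  _⊗_ : Term → Term → Term

infix  6 _≐_
infixr 5 _∧̇_
infixr 4 _∨̇_
infixr 3 _⇒_

data Form : Set where
  ⊥̇    : Form
  _≐_  : Term → Term → Form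
  _∧̇_  : Form → Form → Form
  _∨̇_  : Form → Form → Form
  _⇒_  : Form → Form → Form
  ∀̇    : Form → Form
  ∃̇    : Form → Form

¬̇_ : Form → Form
¬̇ φ = φ ⇒ ⊥̇

_⇔̇_ : Form → Form → Form
φ ⇔̇ ψ = (φ ⇒ ψ) ∧̇ (ψ ⇒ φ)

num : ℕ → Term
num zero    = O
num (suc n) = S (num n)

substT : (ℕ → Term) → Term → Term
substT σ (var n) = σ n
substT σ O       = O
substT σ (S t)   = S (substT σ t)
substT σ (t ⊕ u) = substT σ t ⊕ substT σ u
substT σ (t ⊗ u) = substT σ t ⊗ substT σ u

shiftT : Term → Term
shiftT = substT (λ n → var (suc n))

up : (ℕ → Term) → ℕ → Term
up σ zero    = var zero
up σ (suc n) = shiftT (σ n)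

substF : (ℕ → Term) → Form → Form
substF σ ⊥̇       = ⊥̇
substF σ (t ≐ u) = substT σ t ≐ substT σ u
substF σ (φ ∧̇ ψ) = substF σ φ ∧̇ substF σ ψ
substF σ (φ ∨̇ ψ) = substF σ φ ∨̇ substF σ ψ
substF σ (φ ⇒ ψ) = substF σ φ ⇒ substF σ ψ
substF σ (∀̇ φ)   = ∀̇ (substF (up σ) φ)
substF σ (∃̇ φ)   = ∃̇ (substF (up σ) φ)

shiftF : Form → Form
shiftF = substF (λ n → var (suc n))

_∷ₛ_ : Term → (ℕ → Term) → ℕ → Term
(t ∷ₛ σ) zero    = t
(t ∷ₛ σ) (suc n) = σ n

_[_] : Form → Term → Form
φ [ t ] = substF (t ∷ₛ var) φ

_[_,_] : Form → Term → Term → Form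
φ [ t , s ] = substF (t ∷ₛ (s ∷ₛ var)) φ

data boundedT (n : ℕ) : Term → Set where
  bvar : ∀ {k} → k < n → boundedT n (var k)
  bO   : boundedT n O
  bS   : ∀ {t} → boundedT n t → boundedT n (S t)
  b⊕   : ∀ {t u} → boundedT n t → boundedT n u → boundedT n (t ⊕ u)
  b⊗   : ∀ {t u} → boundedT n t → boundedT n u → boundedT n (t ⊗ u)

data bounded : ℕ → Form → Set where
  b⊥ : ∀ {n} → bounded n ⊥̇
  b≐ : ∀ {n t u} → boundedT n t → boundedT n u → bounded n (t ≐ u)
  b∧ : ∀ {n φ ψ} → bounded n φ → bounded n ψ → bounded n (φ ∧̇ ψ)
  b∨ : ∀ {n φ ψ} → bounded n φ → bounded n ψ → bounded n (φ ∨̇ ψ)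
  b⇒ : ∀ {n φ ψ} → bounded n φ → bounded n ψ → bounded n (φ ⇒ ψ)
  b∀ : ∀ {n φ} → bounded (suc n) φ → bounded n (∀̇ φ)
  b∃ : ∀ {n φ} → bounded (suc n) φ → bounded n (∃̇ φ)

v0 v1 v2 v3 : Term
v0 = var 0
v1 = var 1
v2 = var 2
v3 = var 3

data BaseAx : Form → Set where
  eq-refl  : BaseAx (∀̇ (v0 ≐ v0))
  eq-sym   : BaseAx (∀̇ (∀̇ (v1 ≐ v0 ⇒ v0 ≐ v1)))
  eq-trans : BaseAx (∀̇ (∀̇ (∀̇ (v2 ≐ v1 ⇒ v1 ≐ v0 ⇒ v2 ≐ v0))))
  eq-S     : BaseAx (∀̇ (∀̇ (v1 ≐ v0 ⇒ S v1 ≐ S v0)))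
  eq-⊕     : BaseAx (∀̇ (∀̇ (∀̇ (∀̇ (v3 ≐ v2 ⇒ v1 ≐ v0 ⇒ (v3 ⊕ v1) ≐ (v2 ⊕ v0))))))
  eq-⊗     : BaseAx (∀̇ (∀̇ (∀̇ (∀̇ (v3 ≐ v2 ⇒ v1 ≐ v0 ⇒ (v3 ⊗ v1) ≐ (v2 ⊗ v0))))))
  zero-succ : BaseAx (∀̇ (¬̇ (O ≐ S v0)))
  succ-inj  : BaseAx (∀̇ (∀̇ (S v1 ≐ S v0 ⇒ v1 ≐ v0)))
  add-rec₀  : BaseAx (∀̇ ((O ⊕ v0) ≐ v0))
  add-recS  : BaseAx (∀̇ (∀̇ ((S v1 ⊕ v0) ≐ S (v1 ⊕ v0))))
  mult-rec₀ : BaseAx (∀̇ ((O ⊗ v0) ≐ O))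
  mult-recS : BaseAx (∀̇ (∀̇ ((S v1 ⊗ v0) ≐ (v0 ⊕ (v1 ⊗ v0)))))

-- induction instance:  φ[0] → (∀x. φ(x) → φ(Sx)) → ∀x. φ(x)
-- (other free variables are parameters, universally read by the semantics)
induction : Form → Form
induction φ =
  φ [ O ] ⇒ ∀̇ (φ ⇒ substF (S v0 ∷ₛ (λ n → var (suc n))) φ) ⇒ ∀̇ φ

data QAx : Form → Set where
  base   : ∀ {φ} → BaseAx φ → QAx φ
  zero-or-succ : QAx (∀̇ (v0 ≐ O ∨̇ ∃̇ (v1 ≐ S v0)))

data HAAx : Form → Set where
  base : ∀ {φ} → BaseAx φ → HAAx φ
  ind  : ∀ φ → HAAx (induction φ)

infix 2 _⊢_

data _⊢_ : List Form → Form → Set where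
  ctx  : ∀ {Γ φ} → φ ∈ Γ → Γ ⊢ φ
  exp  : ∀ {Γ φ} → Γ ⊢ ⊥̇ → Γ ⊢ φ
  ⇒I   : ∀ {Γ φ ψ} → (φ ∷ Γ) ⊢ ψ → Γ ⊢ φ ⇒ ψ
  ⇒E   : ∀ {Γ φ ψ} → Γ ⊢ φ ⇒ ψ → Γ ⊢ φ → Γ ⊢ ψ
  ∧I   : ∀ {Γ φ ψ} → Γ ⊢ φ → Γ ⊢ ψ → Γ ⊢ φ ∧̇ ψ
  ∧E₁  : ∀ {Γ φ ψ} → Γ ⊢ φ ∧̇ ψ → Γ ⊢ φ
  ∧E₂  : ∀ {Γ φ ψ} → Γ ⊢ φ ∧̇ ψ → Γ ⊢ ψ
  ∨I₁  : ∀ {Γ φ ψ} → Γ ⊢ φ → Γ ⊢ φ ∨̇ ψ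
  ∨I₂  : ∀ {Γ φ ψ} → Γ ⊢ ψ → Γ ⊢ φ ∨̇ ψ
  ∨E   : ∀ {Γ φ ψ θ} → Γ ⊢ φ ∨̇ ψ → (φ ∷ Γ) ⊢ θ → (ψ ∷ Γ) ⊢ θ → Γ ⊢ θ
  ∀I   : ∀ {Γ φ} → map shiftF Γ ⊢ φ → Γ ⊢ ∀̇ φ
  ∀E   : ∀ {Γ φ} (t : Term) → Γ ⊢ ∀̇ φ → Γ ⊢ φ [ t ]
  ∃I   : ∀ {Γ φ} (t : Term) → Γ ⊢ φ [ t ] → Γ ⊢ ∃̇ φ
  ∃E   : ∀ {Γ φ ψ} → Γ ⊢ ∃̇ φ → (φ ∷ map shiftF Γ) ⊢ shiftF ψ → Γ ⊢ ψ

Q⊢_ : Form → Set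
Q⊢ φ = Σ (List Form) λ Γ → All QAx Γ × (Γ ⊢ φ)

record Structure : Set₁ where
  field
    D    : Set
    i0   : D
    iS   : D → D
    iadd : D → D → D
    imul : D → D → D

module _ (M : Structure) where
  open Structure M

  _∷ᵉ_ : D → (ℕ → D) → ℕ → D
  (d ∷ᵉ ρ) zero    = d
  (d ∷ᵉ ρ) (suc n) = ρ n

  eval : (ℕ → D) → Term → D
  eval ρ (var n) = ρ n
  eval ρ O       = i0
  eval ρ (S t)   = iS (eval ρ t)
  eval ρ (t ⊕ u) = iadd (eval ρ t) (eval ρ u)
  eval ρ (t ⊗ u) = imul (eval ρ t) (eval ρ u)

  sat : (ℕ → D) → Form → Set
  sat ρ ⊥̇       = ⊥
  sat ρ (t ≐ u) = eval ρ t ≡ eval ρ u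
  sat ρ (φ ∧̇ ψ) = sat ρ φ × sat ρ ψ
  sat ρ (φ ∨̇ ψ) = sat ρ φ ⊎ sat ρ ψ
  sat ρ (φ ⇒ ψ) = sat ρ φ → sat ρ ψ
  sat ρ (∀̇ φ)   = (d : D) → sat (d ∷ᵉ ρ) φ
  sat ρ (∃̇ φ)   = Σ D λ d → sat (d ∷ᵉ ρ) φ

  ModelHA : Set
  ModelHA = ∀ φ → HAAx φ → ∀ ρ → sat ρ φ

  numᴹ : ℕ → D
  numᴹ zero    = i0
  numᴹ (suc n) = iS (numᴹ n)

  _∣ᴹ_ : D → D → Set
  x ∣ᴹ y = Σ D λ k → imul x k ≡ y

  std : D → Set
  std e = Σ ℕ λ n → numᴹ n ≡ e

  Stable : (D → Set) → Set
  Stable p = ∀ x → ((p x → ⊥) → ⊥) → p x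

  IsHom : (ℕ → D) → Set
  IsHom h = (h zero ≡ i0)
          × (∀ n → h (suc n) ≡ iS (h n))
          × (∀ m n → h (m + n) ≡ iadd (h m) (h n))
          × (∀ m n → h (m * n) ≡ imul (h m) (h n))

  ≅ℕ : Set
  ≅ℕ = Σ (ℕ → D) λ h → IsHom h × Bijective _≡_ _≡_ h

-- Let Φ(d) be the arithmetical formula "¬¬ some c codes α below d", i.e.
-- ∀ u < d. α(u) ↔ Π(u) ∣ c.  In ℕ every finite pattern of α is ¬¬-coded by
-- a product of distinct primes π(u), so Φ holds at every numeral.  If Φ held
-- at a nonstandard d, its code would work for all standard u at once, which
-- is excluded by hypothesis; by stability of std, Φ(d) therefore forces d to
-- be standard.  Induction in the model now shows Φ(d) and hence std(d) for
-- every d, so the numerals exhaust the model and M ≅ ℕ.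

module Submission where

open import Defs
open import Data.Nat using (ℕ; zero; suc; _+_; _*_; _<_; s≤s; z≤n)
open import Data.Nat.Properties
  using (+-comm; *-comm; m<m+n; m<n⇒m<1+n; m<1+n⇒m<n∨m≡n; n<1+n)
open import Data.Nat.Divisibility using (_∣_; divides; ∣-trans; m∣m*n; n∣m*n; ∣1⇒≡1)
open import Data.Nat.Primality using (Prime; euclidsLemma; prime⇒irreducible; ¬prime[1])
open import Data.Product using (Σ; _×_; proj₁; proj₂; uncurry)
open import Data.Product.Function.NonDependent.Propositional using (_×-⇔_)
open import Data.Product.Function.Dependent.Propositional using (congˡ)
open import Data.Sum using (_⊎_; inj₁; inj₂)
open import Data.Sum.Function.Propositional using (_⊎-⇔_)
open import Data.Empty using (⊥; ⊥-elim)
open import Data.List using (map)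
open import Data.List.Relation.Unary.All using (All; _∷_; lookup)
import Data.List.Relation.Unary.All as All
open import Data.List.Relation.Unary.All.Properties using (map⁺)
open import Function.Bundles using (_⇔_; mk⇔; Equivalence)
open import Function.Construct.Identity using (⇔-id)
open import Function.Construct.Symmetry using (⇔-sym)
open import Function.Construct.Composition using (_⇔-∘_)
open import Function.Definitions using (Injective)
open import Function.Related.TypeIsomorphisms using (→-cong-⇔; ¬-cong-⇔; Related-cong)
open import Relation.Binary.PropositionalEquality
  using (_≡_; refl; sym; trans; cong; cong₂; subst; subst₂; module ≡-Reasoning)
open import Relation.Nullary using (¬_; Dec; yes; no)
open import Relation.Nullary.Negation using (¬¬-map)
open import Relation.Nullary.Decidable using (¬¬-excluded-middle)

open Equivalence using (to; from)

Π-cong-⇔ : ∀ {I : Set} {A B : I → Set} → (∀ i → A i ⇔ B i) → ((i : I) → A i) ⇔ ((i : I) → B i)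
Π-cong-⇔ A⇔B = mk⇔ (λ f i → to (A⇔B i) (f i)) (λ g i → from (A⇔B i) (g i))

≡-cong-⇔ : ∀ {A : Set} {a a′ b b′ : A} → a ≡ a′ → b ≡ b′ → (a ≡ b) ⇔ (a′ ≡ b′)
≡-cong-⇔ p q = mk⇔ (subst₂ _≡_ p q) (subst₂ _≡_ (sym p) (sym q))

module Semantics (M : Structure) where
  open import Data.Product using (_,_)
  open Structure M

  infixr 5 _∷ᵈ_
  _∷ᵈ_ : D → (ℕ → D) → ℕ → D
  _∷ᵈ_ = _∷ᵉ_ M

  ρ₀ : ℕ → D
  ρ₀ _ = i0

  eval-substT : ∀ {σ ρ ρ′} → (∀ n → eval M ρ (σ n) ≡ ρ′ n) →
                ∀ t → eval M ρ (substT σ t) ≡ eval M ρ′ t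
  eval-substT σρ≡ρ′ (var n) = σρ≡ρ′ n
  eval-substT σρ≡ρ′ O       = refl
  eval-substT σρ≡ρ′ (S t)   = cong iS (eval-substT σρ≡ρ′ t)
  eval-substT σρ≡ρ′ (t ⊕ u) = cong₂ iadd (eval-substT σρ≡ρ′ t) (eval-substT σρ≡ρ′ u)
  eval-substT σρ≡ρ′ (t ⊗ u) = cong₂ imul (eval-substT σρ≡ρ′ t) (eval-substT σρ≡ρ′ u)

  eval-up : ∀ {σ ρ ρ′} → (∀ n → eval M ρ (σ n) ≡ ρ′ n) →
            ∀ d n → eval M (d ∷ᵈ ρ) (up σ n) ≡ (d ∷ᵈ ρ′) n
  eval-up σρ≡ρ′ d zero    = refl
  eval-up {σ} σρ≡ρ′ d (suc n) = trans (eval-substT (λ _ → refl) (σ n)) (σρ≡ρ′ n)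

  sat-substF : ∀ {σ ρ ρ′} → (∀ n → eval M ρ (σ n) ≡ ρ′ n) →
               ∀ φ → sat M ρ (substF σ φ) ⇔ sat M ρ′ φ
  sat-substF σρ≡ρ′ ⊥̇       = ⇔-id _
  sat-substF σρ≡ρ′ (t ≐ u) = ≡-cong-⇔ (eval-substT σρ≡ρ′ t) (eval-substT σρ≡ρ′ u)
  sat-substF σρ≡ρ′ (φ ∧̇ ψ) = sat-substF σρ≡ρ′ φ ×-⇔ sat-substF σρ≡ρ′ ψ
  sat-substF σρ≡ρ′ (φ ∨̇ ψ) = sat-substF σρ≡ρ′ φ ⊎-⇔ sat-substF σρ≡ρ′ ψ
  sat-substF σρ≡ρ′ (φ ⇒ ψ) = →-cong-⇔ (sat-substF σρ≡ρ′ φ) (sat-substF σρ≡ρ′ ψ)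
  sat-substF σρ≡ρ′ (∀̇ φ)   = Π-cong-⇔ λ d → sat-substF (eval-up σρ≡ρ′ d) φ
  sat-substF σρ≡ρ′ (∃̇ φ)   = congˡ λ {d} → sat-substF (eval-up σρ≡ρ′ d) φ

  sat-shiftF : ∀ {ρ} d φ → sat M (d ∷ᵈ ρ) (shiftF φ) ⇔ sat M ρ φ
  sat-shiftF d = sat-substF (λ _ → refl)

  sat-[] : ∀ {ρ} φ t → sat M ρ (φ [ t ]) ⇔ sat M (eval M ρ t ∷ᵈ ρ) φ
  sat-[] φ t = sat-substF (λ { zero → refl ; (suc n) → refl }) φ

  sat-⇔̇ : ∀ {ρ} φ ψ → sat M ρ (φ ⇔̇ ψ) ⇔ (sat M ρ φ ⇔ sat M ρ ψ)
  sat-⇔̇ φ ψ = mk⇔ (uncurry mk⇔) (λ φ⇔ψ → to φ⇔ψ , from φ⇔ψ)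

  sat-map-shiftF : ∀ {ρ Γ} d → All (sat M ρ) Γ → All (sat M (d ∷ᵈ ρ)) (map shiftF Γ)
  sat-map-shiftF d ⊨Γ = map⁺ (All.map (λ {φ} → from (sat-shiftF d φ)) ⊨Γ)

  soundness : ∀ {Γ φ} → Γ ⊢ φ → ∀ ρ → All (sat M ρ) Γ → sat M ρ φ
  soundness (ctx φ∈Γ)  ρ ⊨Γ = lookup ⊨Γ φ∈Γ
  soundness (exp ⊢⊥)   ρ ⊨Γ = ⊥-elim (soundness ⊢⊥ ρ ⊨Γ)
  soundness (⇒I ⊢ψ)    ρ ⊨Γ = λ φ → soundness ⊢ψ ρ (φ ∷ ⊨Γ)
  soundness (⇒E ⊢φψ ⊢φ) ρ ⊨Γ = soundness ⊢φψ ρ ⊨Γ (soundness ⊢φ ρ ⊨Γ)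
  soundness (∧I ⊢φ ⊢ψ) ρ ⊨Γ = soundness ⊢φ ρ ⊨Γ , soundness ⊢ψ ρ ⊨Γ
  soundness (∧E₁ ⊢φψ)  ρ ⊨Γ = proj₁ (soundness ⊢φψ ρ ⊨Γ)
  soundness (∧E₂ ⊢φψ)  ρ ⊨Γ = proj₂ (soundness ⊢φψ ρ ⊨Γ)
  soundness (∨I₁ ⊢φ)   ρ ⊨Γ = inj₁ (soundness ⊢φ ρ ⊨Γ)
  soundness (∨I₂ ⊢ψ)   ρ ⊨Γ = inj₂ (soundness ⊢ψ ρ ⊨Γ)
  soundness (∨E ⊢φψ ⊢θ₁ ⊢θ₂) ρ ⊨Γ with soundness ⊢φψ ρ ⊨Γ
  ... | inj₁ φ = soundness ⊢θ₁ ρ (φ ∷ ⊨Γ)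
  ... | inj₂ ψ = soundness ⊢θ₂ ρ (ψ ∷ ⊨Γ)
  soundness (∀I ⊢φ)    ρ ⊨Γ = λ d → soundness ⊢φ (d ∷ᵈ ρ) (sat-map-shiftF d ⊨Γ)
  soundness (∀E {φ = φ} t ⊢∀φ) ρ ⊨Γ = from (sat-[] φ t) (soundness ⊢∀φ ρ ⊨Γ (eval M ρ t))
  soundness (∃I {φ = φ} t ⊢φt) ρ ⊨Γ = eval M ρ t , to (sat-[] φ t) (soundness ⊢φt ρ ⊨Γ)
  soundness (∃E {ψ = ψ} ⊢∃φ ⊢ψ) ρ ⊨Γ with soundness ⊢∃φ ρ ⊨Γ
  ... | d , φd = to (sat-shiftF d ψ) (soundness ⊢ψ (d ∷ᵈ ρ) (φd ∷ sat-map-shiftF d ⊨Γ))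

module ModelOfHA (M : Structure) (model : ModelHA M) where
  open import Data.Product using (_,_)
  open Structure M
  open Semantics M

  axiom : ∀ {φ} → BaseAx φ → sat M ρ₀ φ
  axiom ax = model _ (base ax) ρ₀

  add-zero : ∀ a → iadd i0 a ≡ a
  add-zero = axiom add-rec₀

  add-suc : ∀ a b → iadd (iS a) b ≡ iS (iadd a b)
  add-suc = axiom add-recS

  mul-zero : ∀ a → imul i0 a ≡ i0
  mul-zero = axiom mult-rec₀

  mul-suc : ∀ a b → imul (iS a) b ≡ iadd b (imul a b)
  mul-suc = axiom mult-recS

  zero≢suc : ∀ a → i0 ≡ iS a → ⊥
  zero≢suc = axiom zero-succ

  suc-injective : ∀ a b → iS a ≡ iS b → a ≡ b
  suc-injective = axiom succ-inj

  sat-induction : ∀ φ ρ → sat M (i0 ∷ᵈ ρ) φ →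
                  (∀ d → sat M (d ∷ᵈ ρ) φ → sat M (iS d ∷ᵈ ρ) φ) →
                  ∀ d → sat M (d ∷ᵈ ρ) φ
  sat-induction φ ρ φ0 step =
    model _ (ind φ) ρ (from (sat-[] φ O) φ0)
      λ d φd → from (sat-substF (λ { zero → refl ; (suc n) → refl }) φ) (step d φd)

  zero-or-suc : ∀ d → d ≡ i0 ⊎ Σ D λ d′ → d ≡ iS d′
  zero-or-suc = sat-induction (v0 ≐ O ∨̇ ∃̇ (v1 ≐ S v0)) ρ₀ (inj₁ refl) λ d _ → inj₂ (d , refl)

  Q-soundness : ∀ {φ} → Q⊢ φ → ∀ ρ → sat M ρ φ
  Q-soundness (Γ , axioms , ⊢φ) ρ = soundness ⊢φ ρ (All.map sat-QAx axioms)
    where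
    sat-QAx : ∀ {ψ} → QAx ψ → sat M ρ ψ
    sat-QAx (base ax)    = model _ (base ax) ρ
    sat-QAx zero-or-succ = zero-or-suc

  eval-num : ∀ ρ n → eval M ρ (num n) ≡ numᴹ M n
  eval-num ρ zero    = refl
  eval-num ρ (suc n) = cong iS (eval-num ρ n)

  numᴹ-+ : ∀ m n → numᴹ M (m + n) ≡ iadd (numᴹ M m) (numᴹ M n)
  numᴹ-+ zero    n = sym (add-zero (numᴹ M n))
  numᴹ-+ (suc m) n = trans (cong iS (numᴹ-+ m n)) (sym (add-suc (numᴹ M m) (numᴹ M n)))

  numᴹ-* : ∀ m n → numᴹ M (m * n) ≡ imul (numᴹ M m) (numᴹ M n)
  numᴹ-* zero    n = sym (mul-zero (numᴹ M n))
  numᴹ-* (suc m) n = begin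
    numᴹ M (n + m * n)                            ≡⟨ numᴹ-+ n (m * n) ⟩
    iadd (numᴹ M n) (numᴹ M (m * n))              ≡⟨ cong (iadd (numᴹ M n)) (numᴹ-* m n) ⟩
    iadd (numᴹ M n) (imul (numᴹ M m) (numᴹ M n))  ≡⟨ sym (mul-suc (numᴹ M m) (numᴹ M n)) ⟩
    imul (numᴹ M (suc m)) (numᴹ M n)              ∎
    where open ≡-Reasoning

  numᴹ-injective : Injective _≡_ _≡_ (numᴹ M)
  numᴹ-injective {zero}  {zero}  _  = refl
  numᴹ-injective {zero}  {suc n} eq = ⊥-elim (zero≢suc _ eq)
  numᴹ-injective {suc m} {zero}  eq = ⊥-elim (zero≢suc _ (sym eq))
  numᴹ-injective {suc m} {suc n} eq = cong suc (numᴹ-injective (suc-injective _ _ eq))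

  all-std⇒≅ℕ : (∀ d → std M d) → ≅ℕ M
  all-std⇒≅ℕ all-std =
    numᴹ M , (refl , (λ _ → refl) , numᴹ-+ , numᴹ-*) , numᴹ-injective , surjective
    where
    surjective : ∀ d → Σ ℕ λ n → ∀ {m} → m ≡ n → numᴹ M m ≡ d
    surjective d with all-std d
    ... | n , nᴹ≡d = n , λ { refl → nᴹ≡d }

  +≡numᴹ-inv : ∀ n a b → iadd a b ≡ numᴹ M n →
               Σ ℕ λ m → Σ ℕ λ k → a ≡ numᴹ M m × b ≡ numᴹ M k × m + k ≡ n
  +≡numᴹ-inv n a b a+b≡n with zero-or-suc a
  ... | inj₁ refl = 0 , n , refl , trans (sym (add-zero b)) a+b≡n , refl
  +≡numᴹ-inv zero a b a+b≡0 | inj₂ (a′ , refl) =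
    ⊥-elim (zero≢suc _ (sym (trans (sym (add-suc a′ b)) a+b≡0)))
  +≡numᴹ-inv (suc n) a b a+b≡n | inj₂ (a′ , refl)
    with +≡numᴹ-inv n a′ b (suc-injective _ _ (trans (sym (add-suc a′ b)) a+b≡n))
  ... | m , k , refl , b≡k , m+k≡n = suc m , k , refl , b≡k , cong suc m+k≡n

  numᴹ-+-suc : ∀ m b → iadd (numᴹ M m) (iS b) ≡ iS (iadd (numᴹ M m) b)
  numᴹ-+-suc zero    b = trans (add-zero (iS b)) (cong iS (sym (add-zero b)))
  numᴹ-+-suc (suc m) b = begin
    iadd (iS (numᴹ M m)) (iS b)  ≡⟨ add-suc (numᴹ M m) (iS b) ⟩
    iS (iadd (numᴹ M m) (iS b))  ≡⟨ cong iS (numᴹ-+-suc m b) ⟩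
    iS (iS (iadd (numᴹ M m) b))  ≡⟨ cong iS (sym (add-suc (numᴹ M m) b)) ⟩
    iS (iadd (iS (numᴹ M m)) b)  ∎
    where open ≡-Reasoning

  _<ᴹ_ : D → D → Set
  a <ᴹ b = Σ D λ k → iadd a (iS k) ≡ b

  <ᴹ-numᴹ-inv : ∀ {a n} → a <ᴹ numᴹ M n → Σ ℕ λ m → m < n × a ≡ numᴹ M m
  <ᴹ-numᴹ-inv {a} {n} (k , a+1+k≡n) with +≡numᴹ-inv n a (iS k) a+1+k≡n
  ... | m , zero  , _   , 1+k≡0 , _     = ⊥-elim (zero≢suc k (sym 1+k≡0))
  ... | m , suc j , a≡m , _     , m+j≡n = m , subst (m <_) m+j≡n (m<m+n m (s≤s z≤n)) , a≡m

  numᴹ<ᴹnonstandard : ∀ {d} → ¬ std M d → ∀ n → numᴹ M n <ᴹ d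
  numᴹ<ᴹnonstandard {d} nonstd zero with zero-or-suc d
  ... | inj₁ refl        = ⊥-elim (nonstd (0 , refl))
  ... | inj₂ (d′ , refl) = d′ , add-zero (iS d′)
  numᴹ<ᴹnonstandard nonstd (suc n) with numᴹ<ᴹnonstandard nonstd n
  ... | k , n+1+k≡d with zero-or-suc k
  ...   | inj₁ refl =
    ⊥-elim (nonstd (suc n , trans (cong (numᴹ M) (+-comm 1 n)) (trans (numᴹ-+ n 1) n+1+k≡d)))
  ...   | inj₂ (k′ , refl) =
    k′ , trans (add-suc (numᴹ M n) (iS k′)) (trans (sym (numᴹ-+-suc n (iS k′))) n+1+k≡d)

  numᴹ-∣ᴹ⇔∣ : ∀ a n → _∣ᴹ_ M (numᴹ M a) (numᴹ M n) ⇔ a ∣ n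
  numᴹ-∣ᴹ⇔∣ a n = mk⇔ (∣ᴹ⇒∣ a) ∣⇒∣ᴹ
    where
    ∣ᴹ⇒∣ : ∀ a → _∣ᴹ_ M (numᴹ M a) (numᴹ M n) → a ∣ n
    ∣ᴹ⇒∣ zero (k , 0k≡n) = divides 0 (numᴹ-injective (trans (sym 0k≡n) (mul-zero k)))
    ∣ᴹ⇒∣ (suc a) (k , ak≡n)
      with +≡numᴹ-inv n k (imul (numᴹ M a) k) (trans (sym (mul-suc (numᴹ M a) k)) ak≡n)
    ... | m , _ , refl , _ , _ =
      divides m (trans (sym (numᴹ-injective (trans (numᴹ-* (suc a) m) ak≡n))) (*-comm (suc a) m))

    ∣⇒∣ᴹ : a ∣ n → _∣ᴹ_ M (numᴹ M a) (numᴹ M n)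
    ∣⇒∣ᴹ (divides q n≡q*a) = numᴹ M q , (begin
      imul (numᴹ M a) (numᴹ M q)  ≡⟨ sym (numᴹ-* a q) ⟩
      numᴹ M (a * q)              ≡⟨ cong (numᴹ M) (*-comm a q) ⟩
      numᴹ M (q * a)              ≡⟨ cong (numᴹ M) (sym n≡q*a) ⟩
      numᴹ M n                    ∎)
      where open ≡-Reasoning

  overspill : Stable M (std M) → ∀ φ ρ → (∀ n → sat M (numᴹ M n ∷ᵈ ρ) φ) →
              (∀ d → sat M (d ∷ᵈ ρ) φ → ¬ ¬ std M d) → ∀ d → std M d
  overspill stable φ ρ φ-numerals φ⇒¬¬std d = stable d (φ⇒¬¬std d (φ-everywhere d))
    where
    step : ∀ d → sat M (d ∷ᵈ ρ) φ → sat M (iS d ∷ᵈ ρ) φ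
    step d φd with stable d (φ⇒¬¬std d φd)
    ... | n , refl = φ-numerals (suc n)

    φ-everywhere : ∀ d → sat M (d ∷ᵈ ρ) φ
    φ-everywhere = sat-induction φ ρ (φ-numerals 0) step

module PrimeCoding (π : ℕ → ℕ) (π-injective : Injective _≡_ _≡_ π) (π-prime : ∀ n → Prime (π n)) where
  open import Data.Product using (_,_)

  π≢1 : ∀ m → π m ≡ 1 → ⊥
  π≢1 m πm≡1 = ¬prime[1] (subst Prime πm≡1 (π-prime m))

  π-∣-injective : ∀ {m n} → π m ∣ π n → m ≡ n
  π-∣-injective {m} {n} πm∣πn with prime⇒irreducible (π-prime n) πm∣πn
  ... | inj₁ πm≡1  = ⊥-elim (π≢1 m πm≡1)
  ... | inj₂ πm≡πn = π-injective πm≡πn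

  CodesBelow : (ℕ → Set) → ℕ → ℕ → Set
  CodesBelow P n N = ∀ m → π m ∣ N ⇔ (m < n × P m)

  code-below : ∀ {P n N} → CodesBelow P n N → ∀ {m} → m < n → P m ⇔ π m ∣ N
  code-below code {m} m<n = mk⇔ (λ Pm → from (code m) (m<n , Pm)) (λ πm∣N → proj₂ (to (code m) πm∣N))

  code-extend : ∀ {P n N} → CodesBelow P n N → Dec (P n) → Σ ℕ (CodesBelow P (suc n))
  code-extend {P} {n} {N} code (yes Pn) = N * π n , λ m → mk⇔ (to-code m) (from-code m)
    where
    to-code : ∀ m → π m ∣ N * π n → m < suc n × P m
    to-code m πm∣Nπn with euclidsLemma N (π n) (π-prime m) πm∣Nπn
    ... | inj₁ πm∣N  = let m<n , Pm = to (code m) πm∣N in m<n⇒m<1+n m<n , Pm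
    ... | inj₂ πm∣πn with π-∣-injective πm∣πn
    ...   | refl = n<1+n n , Pn

    from-code : ∀ m → m < suc n × P m → π m ∣ N * π n
    from-code m (m<1+n , Pm) with m<1+n⇒m<n∨m≡n m<1+n
    ... | inj₁ m<n  = ∣-trans (from (code m) (m<n , Pm)) (m∣m*n (π n))
    ... | inj₂ refl = n∣m*n N
  code-extend {P} {n} {N} code (no ¬Pn) = N , λ m → mk⇔ (to-code m) (from-code m)
    where
    to-code : ∀ m → π m ∣ N → m < suc n × P m
    to-code m πm∣N = let m<n , Pm = to (code m) πm∣N in m<n⇒m<1+n m<n , Pm

    from-code : ∀ m → m < suc n × P m → π m ∣ N
    from-code m (m<1+n , Pm) with m<1+n⇒m<n∨m≡n m<1+n
    ... | inj₁ m<n  = from (code m) (m<n , Pm)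
    ... | inj₂ refl = ⊥-elim (¬Pn Pm)

  ¬¬-code : ∀ P n → ¬ ¬ Σ ℕ (CodesBelow P n)
  ¬¬-code P zero ¬code = ¬code (1 , λ m → mk⇔ (λ πm∣1 → ⊥-elim (π≢1 m (∣1⇒≡1 πm∣1))) λ ())
  ¬¬-code P (suc n) ¬code =
    ¬¬-code P n λ (N , code) → ¬¬-excluded-middle λ Pn? → ¬code (code-extend code Pn?)

module ArithmeticalCoding
  (M : Structure) (model : ModelHA M)
  (π : ℕ → ℕ) (π-injective : Injective _≡_ _≡_ π) (π-prime : ∀ n → Prime (π n))
  (Πf : Form) (Π-represents : ∀ n → Q⊢ ∀̇ ((_[_,_] Πf (num n) v0) ⇔̇ (num (π n) ≐ v0)))
  (α : Form)
  where
  open import Data.Product using (_,_)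
  open Structure M
  open Semantics M
  open ModelOfHA M model
  open PrimeCoding π π-injective π-prime

  A : D → Set
  A u = sat M (u ∷ᵈ ρ₀) α

  -- Πf [ t , v0 ] sends variable 2 of Πf to v0 as well, so p fills the third
  -- slot too; this matches the statement without appealing to bounded 2 Πf.
  Πᴹ : D → D → Set
  Πᴹ u p = sat M (u ∷ᵈ p ∷ᵈ p ∷ᵈ ρ₀) Πf

  CodedBy : D → Set
  CodedBy c = ∀ u → sat M ρ₀ (α [ num u ])
    ⇔ Σ D λ p → sat M (p ∷ᵈ ρ₀) (_[_,_] Πf (num u) v0) × _∣ᴹ_ M p c

  CodedBelow : D → D → Set
  CodedBelow d c = ∀ u → u <ᴹ d → A u ⇔ Σ D λ p → Πᴹ u p × _∣ᴹ_ M p c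

  Codable : D → Set
  Codable d = ¬ ¬ Σ D (CodedBelow d)

  α′ Π′ : Form
  α′ = substF (v0 ∷ₛ λ _ → O) α
  Π′ = substF (v1 ∷ₛ (v0 ∷ₛ (v0 ∷ₛ λ _ → O))) Πf

  -- Φ(d) = ¬¬ ∃c ∀u. (∃k. u + S k = d) → (α(u) ↔ ∃p. Π(u, p) ∧ ∃k. p × k = c)
  Φ : Form
  Φ = ¬̇ ¬̇ ∃̇ (∀̇ (∃̇ ((v1 ⊕ S v0) ≐ v3) ⇒ (α′ ⇔̇ ∃̇ (Π′ ∧̇ ∃̇ ((v1 ⊗ v0) ≐ v3)))))

  sat-Φ : ∀ d → sat M (d ∷ᵈ ρ₀) Φ ⇔ Codable d
  sat-Φ d = ¬-cong-⇔ (¬-cong-⇔ (congˡ λ {c} → Π-cong-⇔ λ u →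
    →-cong-⇔ (⇔-id _)
      (Related-cong
         (sat-substF (λ { zero → refl ; (suc n) → refl }) α)
         (congˡ λ {p} →
            sat-substF (λ { zero → refl ; (suc zero) → refl ; (suc (suc zero)) → refl
                          ; (suc (suc (suc n))) → refl }) Πf
            ×-⇔ ⇔-id _)
       ⇔-∘ sat-⇔̇ α′ (∃̇ (Π′ ∧̇ ∃̇ ((v1 ⊗ v0) ≐ v3))))))

  sat-α[num] : ∀ u → sat M ρ₀ (α [ num u ]) ⇔ A (numᴹ M u)
  sat-α[num] u = sat-substF (λ { zero → eval-num ρ₀ u ; (suc n) → refl }) α

  sat-Π[num] : ∀ u p → sat M (p ∷ᵈ ρ₀) (_[_,_] Πf (num u) v0) ⇔ Πᴹ (numᴹ M u) p
  sat-Π[num] u p =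
    sat-substF (λ { zero → eval-num _ u ; (suc zero) → refl ; (suc (suc zero)) → refl
                  ; (suc (suc (suc n))) → refl }) Πf

  Πᴹ-numeral : ∀ u p → Πᴹ (numᴹ M u) p ⇔ (numᴹ M (π u) ≡ p)
  Πᴹ-numeral u p =
    ≡-cong-⇔ (eval-num _ (π u)) refl
      ⇔-∘ (to (sat-⇔̇ (_[_,_] Πf (num u) v0) (num (π u) ≐ v0)) (Q-soundness (Π-represents u) ρ₀ p)
      ⇔-∘ ⇔-sym (sat-Π[num] u p))

  Πᴹ-numeral-∣ᴹ : ∀ u c → (Σ D λ p → Πᴹ (numᴹ M u) p × _∣ᴹ_ M p c) ⇔ _∣ᴹ_ M (numᴹ M (π u)) c
  Πᴹ-numeral-∣ᴹ u c = mk⇔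
    (λ (p , Πup , p∣c) → subst (λ q → _∣ᴹ_ M q c) (sym (to (Πᴹ-numeral u p) Πup)) p∣c)
    (λ πu∣c → numᴹ M (π u) , from (Πᴹ-numeral u _) refl , πu∣c)

  codable-numeral : ∀ n → Codable (numᴹ M n)
  codable-numeral n = ¬¬-map (λ (N , code) → numᴹ M N , coded-below code) (¬¬-code (λ m → A (numᴹ M m)) n)
    where
    coded-below : ∀ {N} → CodesBelow (λ m → A (numᴹ M m)) n N → CodedBelow (numᴹ M n) (numᴹ M N)
    coded-below {N} code u u<n with <ᴹ-numᴹ-inv u<n
    ... | m , m<n , refl =
      ⇔-sym (Πᴹ-numeral-∣ᴹ m (numᴹ M N)) ⇔-∘ (⇔-sym (numᴹ-∣ᴹ⇔∣ (π m) N) ⇔-∘ code-below code m<n)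

  nonstandard-coded : ∀ {d c} → ¬ std M d → CodedBelow d c → CodedBy c
  nonstandard-coded nonstd coded u =
    congˡ (λ {p} → ⇔-sym (sat-Π[num] u p) ×-⇔ ⇔-id _)
      ⇔-∘ (coded (numᴹ M u) (numᴹ<ᴹnonstandard nonstd u)
      ⇔-∘ sat-α[num] u)

  codable⇒¬¬std : ¬ Σ D CodedBy → ∀ d → Codable d → ¬ ¬ std M d
  codable⇒¬¬std uncodable d codable nonstd =
    codable λ (c , coded) → uncodable (c , nonstandard-coded nonstd coded)

open Structure using (D; i0)

lemma5p5 : (M : Structure) → ModelHA M → Stable M (std M) → ¬ ≅ℕ M →
    (π : ℕ → ℕ) → Injective _≡_ _≡_ π → (∀ n → Prime (π n)) →
    (Πf : Form) → bounded 2 Πf →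
    (∀ n → Q⊢ ∀̇ ((Πf [ num n , v0 ]) ⇔̇ (num (π n) ≐ v0))) →
    (α : Form) → bounded 1 α →
    ¬ ¬ (Σ (D M) λ c → (u : ℕ) →
      sat M (λ _ → i0 M) (α [ num u ])
        ⇔ Σ (D M) λ p →
            sat M (_∷ᵉ_ M p (λ _ → i0 M)) (Πf [ num u , v0 ]) × _∣ᴹ_ M p c)
lemma5p5 M model stable ≇ℕ π π-injective π-prime Πf _ Π-represents α _ uncodable =
  ≇ℕ (all-std⇒≅ℕ (overspill stable Φ ρ₀
    (λ n → from (sat-Φ _) (codable-numeral n))
    (λ d Φd → codable⇒¬¬std uncodable d (to (sat-Φ d) Φd))))
  where
  open Semantics M
  open ModelOfHA M model
  open ArithmeticalCoding M model π π-injective π-prime Πf Π-represents α
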